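{- Let $\mathbf{A}$ be a semilattice. Then the pair $\langle E(X(\mathbf{A})),\beta\rangle$ is a canonical extension of $\mathbf{A}$.
   Context: A semilattice is a meet-semilattice with top $\langle A,\wedge,1\rangle$. A filter is an upset containing $1$ closed under $\wedge$; a proper filter $F$ is irreducible if $F=F_1\cap F_2$ for filters $F_1,F_2$ implies $F=F_1$ or $F=F_2$. $X(\mathbf{A})$ is the set of irreducible filters, $\beta(a)=\{P\in X(\mathbf{A})\colon a\in P\}$, and $X(\mathbf{A})$ carries the topology with subbase $\mathcal{K}_\mathbf{A}=\{\beta(a)^c\colon a\in A\}$. A subset $Z\subseteq X(\mathbf{A})$ is subbasic saturated if $Z=\bigcap\mathcal{L}$ for some dually directed family $\mathcal{L}\subseteq\mathcal{K}_\mathbf{A}$ (for $U,V\in\mathcal{L}$ there is $W\in\mathcal{L}$, $W\subseteq U\cap V$); $\mathcal{Z}(X(\mathbf{A}))$ denotes their set. $E(X(\mathbf{A}))=\{\bigcap\{U^c\colon U\in\mathcal{B}\}\colon \mathcal{B}\subseteq\mathcal{Z}(X(\mathbf{A}))\}$, a complete lattice under inclusion. An order-ideal is a nonempty directed downset. A completion of $\mathbf{A}$ is a pair $\langle E,e\rangle$ with $E$ a complete lattice and $e\colon A\to E$ a semilattice embedding. $x\in E$ is closed if $x=\bigwedge e[F]$ for some filter $F$, open if $x=\bigvee e[I]$ for some order-ideal $I$. The completion is dense if every $x\in E$ is the meet of the open elements above it and the join of the closed elements below it; it is compact if whenever $D\subseteq A$ is nonempty dually directed, $U\subseteq A$ nonempty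 directed, and $\bigwedge e[D]\le\bigvee e[U]$, there are $x\in D$, $y\in U$ with $x\le y$. A canonical extension is a dense compact completion. -}

module Defs where

open import Level using (Level; _⊔_; suc; Setω)
open import Data.Product using (Σ; ∃; ∃₂; _×_; _,_; proj₁; proj₂)
open import Data.Sum using (_⊎_; inj₁; inj₂)
open import Relation.Nullary using (¬_; Dec)
open import Relation.Unary using (Pred; _⊆_; _≐_; _∩_)
open import Relation.Binary.Bundles using (Poset)
open import Relation.Binary.Structures using (IsPartialOrder; IsPreorder; IsEquivalence)
open import Relation.Binary.Lattice.Bundles using (BoundedMeetSemilattice)

-- Classical metatheory (the paper works in ZFC)

ExcludedMiddle : Setω
ExcludedMiddle = ∀ {a} (P : Set a) → Dec P

module _ {a ℓ₁ ℓ₂} (P : Poset a ℓ₁ ℓ₂) where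
  open Poset P

  IsChain : Pred Carrier (a ⊔ ℓ₁ ⊔ ℓ₂) → Set (a ⊔ ℓ₁ ⊔ ℓ₂)
  IsChain C = ∀ x y → C x → C y → (x ≤ y) ⊎ (y ≤ x)

  IsUpperBoundOf : Pred Carrier (a ⊔ ℓ₁ ⊔ ℓ₂) → Carrier → Set (a ⊔ ℓ₁ ⊔ ℓ₂)
  IsUpperBoundOf C u = ∀ x → C x → x ≤ u

  IsMaximal : Carrier → Set (a ⊔ ℓ₂)
  IsMaximal m = ∀ y → m ≤ y → y ≤ m

ZornsLemma : Setω
ZornsLemma = ∀ {a ℓ₁ ℓ₂} (P : Poset a ℓ₁ ℓ₂) →
  (∀ (C : Pred (Poset.Carrier P) (a ⊔ ℓ₁ ⊔ ℓ₂)) → IsChain P C → ∃ (IsUpperBoundOf P C)) →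
  ∃ (IsMaximal P)

module _ {c ℓ₁ ℓ₂} (P : Poset c ℓ₁ ℓ₂) where
  open Poset P

  IsLowerBound : ∀ {ℓ} → Pred Carrier ℓ → Carrier → Set (c ⊔ ℓ ⊔ ℓ₂)
  IsLowerBound S x = ∀ y → S y → x ≤ y

  IsUpperBound : ∀ {ℓ} → Pred Carrier ℓ → Carrier → Set (c ⊔ ℓ ⊔ ℓ₂)
  IsUpperBound S x = ∀ y → S y → y ≤ x

  IsGlb : ∀ {ℓ} → Pred Carrier ℓ → Carrier → Set (c ⊔ ℓ ⊔ ℓ₂)
  IsGlb S x = IsLowerBound S x × (∀ z → IsLowerBound S z → z ≤ x)

  IsLub : ∀ {ℓ} → Pred Carrier ℓ → Carrier → Set (c ⊔ ℓ ⊔ ℓ₂)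
  IsLub S x = IsUpperBound S x × (∀ z → IsUpperBound S z → x ≤ z)

  IsCompleteLattice : Set (suc c ⊔ ℓ₂)
  IsCompleteLattice = ∀ (S : Pred Carrier c) → ∃ (IsGlb S) × ∃ (IsLub S)

module SL {c ℓ₁ ℓ₂} (A : BoundedMeetSemilattice c ℓ₁ ℓ₂) where
  open BoundedMeetSemilattice A

  ℓA : Level
  ℓA = c ⊔ ℓ₁ ⊔ ℓ₂

  Subset : Set (c ⊔ suc ℓA)
  Subset = Pred Carrier ℓA

  Nonempty : Subset → Set ℓA
  Nonempty S = ∃ S

  IsUpset : Subset → Set ℓA
  IsUpset F = ∀ {a b} → a ≤ b → F a → F b

  IsDownset : Subset → Set ℓA
  IsDownset I = ∀ {a b} → b ≤ a → I a → I b

  IsDirected : Subset → Set ℓA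
  IsDirected U = ∀ a b → U a → U b → ∃ λ d → U d × a ≤ d × b ≤ d

  IsDuallyDirected : Subset → Set ℓA
  IsDuallyDirected D = ∀ a b → D a → D b → ∃ λ d → D d × d ≤ a × d ≤ b

  IsFilter : Subset → Set ℓA
  IsFilter F = IsUpset F × F ⊤ × (∀ {a b} → F a → F b → F (a ∧ b))

  IsProper : Subset → Set ℓA
  IsProper F = ¬ (∀ a → F a)

  IsIrreducible : Subset → Set (suc ℓA)
  IsIrreducible F =
    IsFilter F × IsProper F ×
    (∀ (F₁ F₂ : Subset) → IsFilter F₁ → IsFilter F₂ →
       F ≐ (F₁ ∩ F₂) → (F ≐ F₁) ⊎ (F ≐ F₂))

  IsOrderIdeal : Subset → Set ℓA
  IsOrderIdeal I = Nonempty I × IsDownset I × IsDirected I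

  X : Set (suc ℓA)
  X = Σ Subset IsIrreducible

  β : Carrier → Pred X ℓA
  β a P = proj₁ P a

  ∁ : Pred X ℓA → Pred X ℓA
  ∁ U P = ¬ U P

  -- A subfamily L ⊆ 𝒦_A = { β(a)^c : a ∈ A } is given as the image
  -- { β(a)^c : a ∈ S } of a subset S ⊆ A.  It is dually directed iff
  -- for U, V ∈ L there is W ∈ L with W ⊆ U ∩ V.
  IsDuallyDirectedFamily : Subset → Set (suc ℓA)
  IsDuallyDirectedFamily S =
    ∀ a b → S a → S b → ∃ λ d → S d × (∁ (β d) ⊆ (∁ (β a) ∩ ∁ (β b)))

  ⋂K : Subset → Pred X ℓA
  ⋂K S P = ∀ a → S a → ∁ (β a) P

  IsSubbasicSaturated : Pred X ℓA → Set (suc ℓA)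
  IsSubbasicSaturated Z = ∃ λ (S : Subset) → IsDuallyDirectedFamily S × (Z ≐ ⋂K S)

  InE : Pred X ℓA → Set (suc ℓA)
  InE Y = ∃ λ (ℬ : Pred (Pred X ℓA) ℓA) →
            (∀ U → ℬ U → IsSubbasicSaturated U) ×
            (Y ≐ (λ P → ∀ U → ℬ U → ∁ U P))

  EX : Set (suc ℓA)
  EX = Σ (Pred X ℓA) InE

  EXposet : Poset (suc ℓA) (suc ℓA) (suc ℓA)
  EXposet = record
    { Carrier = EX
    ; _≈_ = λ Y Z → proj₁ Y ≐ proj₁ Z
    ; _≤_ = λ Y Z → proj₁ Y ⊆ proj₁ Z
    ; isPartialOrder = record
      { isPreorder = record
        { isEquivalence = record
          { refl = (λ x → x) , (λ x → x)
          ; sym = λ (p , q) → q , p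
          ; trans = λ (p , q) (p′ , q′) → (λ x → p′ (p x)) , (λ x → q (q′ x))
          }
        ; reflexive = proj₁
        ; trans = λ p q x → q (p x)
        }
      ; antisym = λ p q → p , q
      }
    }

  module _ {cE ℓ₁E ℓ₂E} (E : Poset cE ℓ₁E ℓ₂E) (e : Carrier → Poset.Carrier E) where
    private
      module E = Poset E

    image : Subset → Pred E.Carrier (ℓA ⊔ ℓ₁E)
    image S z = ∃ λ a → S a × (z E.≈ e a)

    IsSemilatticeEmbedding : Set _
    IsSemilatticeEmbedding =
      (∀ {a b} → a ≈ b → e a E.≈ e b) ×
      (∀ {a b} → e a E.≈ e b → a ≈ b) ×
      (∀ a b → IsGlb E (λ z → (z E.≈ e a) ⊎ (z E.≈ e b)) (e (a ∧ b))) ×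
      (∀ z → z E.≤ e ⊤)

    IsCompletion : Set _
    IsCompletion = IsCompleteLattice E × IsSemilatticeEmbedding

    IsClosed : E.Carrier → Set _
    IsClosed x = ∃ λ (F : Subset) → IsFilter F × IsGlb E (image F) x

    IsOpen : E.Carrier → Set _
    IsOpen x = ∃ λ (I : Subset) → IsOrderIdeal I × IsLub E (image I) x

    IsDense : Set _
    IsDense = ∀ x →
      IsGlb E (λ o → IsOpen o × x E.≤ o) x ×
      IsLub E (λ k → IsClosed k × k E.≤ x) x

    IsCompact : Set _
    IsCompact = ∀ (D U : Subset) →
      Nonempty D → IsDuallyDirected D → Nonempty U → IsDirected U →
      ∀ m j → IsGlb E (image D) m → IsLub E (image U) j → m E.≤ j →
      ∃₂ λ x y → D x × U y × x ≤ y

    IsCanonicalExtension : Set _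
    IsCanonicalExtension = IsCompletion × IsDense × IsCompact

-- The members of E(X(A)) are the sets ⋂ {Uᶜ : U ∈ ℬ}, so E(X(A)) is closed under
-- intersections (take the union of the families ℬ) and is a complete lattice; β(a) lies in
-- it as the complement of the subbasic saturated set ⋂ {β(b)ᶜ : b ≤ a}. Everything else
-- rests on the prime filter theorem, obtained from Zorn's lemma: a filter disjoint from a
-- nonempty directed set extends to an irreducible filter disjoint from it. It gives that β
-- reflects the order, and compactness by separating the filter generated by D from U. For
-- density, a point P ∈ x lies in the closed element ⋂ {β(a) : a ∈ P}, which is contained in
-- x because members of E(X(A)) are up-closed; a point P ∉ x lies in some ⋂ {β(a)ᶜ : a ∈ S}
-- from the family of x, and then the open element ⋃ {β(b) : b ≤ a ∈ S} contains x and
-- misses P (S is directed by the reflection of the order).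
{-# OPTIONS --safe #-}
module Submission where

open import Defs
open import Relation.Unary using (_≐_)
open import Data.Product using (∃; _×_; proj₁)
open import Relation.Binary.Lattice.Bundles using (BoundedMeetSemilattice)

open import Level using (Lift; lift; lower; _⊔_) renaming (suc to lsuc)
open import Data.Product using (Σ; _,_; proj₂)
open import Data.Sum using (_⊎_; inj₁; inj₂)
open import Data.Empty using (⊥-elim)
open import Function using (_∘_; id)
open import Relation.Nullary using (¬_; yes; no)
open import Relation.Nullary.Decidable using (True; toWitness; fromWitness; decidable-stable)
open import Relation.Unary using (Pred; _⊆_; _∩_; _≬_)
open import Relation.Unary.Properties using (≐-refl; ≐-trans)
open import Relation.Unary.Relation.Binary.Subset using (⊆-poset)
open import Relation.Binary.Bundles using (Poset)
import Relation.Binary.Construct.On as On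

module _ {c ℓ₁ ℓ₂} (P : Poset c ℓ₁ ℓ₂) where
  open Poset P

  lubs-from-glbs : (∀ (S : Pred Carrier (c ⊔ ℓ₂)) → ∃ (IsGlb P S)) →
                   ∀ (S : Pred Carrier (c ⊔ ℓ₂)) → ∃ (IsLub P S)
  lubs-from-glbs glb S =
    let (u , u-lower , u-greatest) = glb (IsUpperBound P S)
    in u , (λ x x∈S → u-greatest x (λ y y-upper → y-upper x x∈S)) , u-lower

module Classical (lem : ExcludedMiddle) where

  dne : ∀ {a} {A : Set a} → ¬ ¬ A → A
  dne = decidable-stable (lem _)

  -- With excluded middle every proposition has an equivalent copy in any universe; this is
  -- how the families of subsets of X(A) below, which quantify over X(A), are brought down
  -- to the level the definition of E(X(A)) demands.
  Resized : ∀ {a} ℓ → Set a → Set ℓ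
  Resized ℓ A = Lift ℓ (True (lem A))

  resize : ∀ {a ℓ} {A : Set a} → A → Resized ℓ A
  resize x = lift (fromWitness x)

  unresize : ∀ {a ℓ} {A : Set a} → Resized ℓ A → A
  unresize r = toWitness (lower r)

module _ {c ℓ₁ ℓ₂} (A : BoundedMeetSemilattice c ℓ₁ ℓ₂) where
  open BoundedMeetSemilattice A
  open SL A

  ↑ ↓ : Carrier → Subset
  ↑ a x = Lift ℓA (a ≤ x)
  ↓ a x = Lift ℓA (x ≤ a)

  UpClosure DownClosure : Subset → Subset
  UpClosure D x = ∃ λ d → D d × d ≤ x
  DownClosure S x = ∃ λ a → S a × x ≤ a

  ↑-isFilter : ∀ a → IsFilter (↑ a)
  ↑-isFilter a =
    (λ x≤y a≤x → lift (trans (lower a≤x) x≤y)) ,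
    lift (maximum a) ,
    (λ a≤x a≤y → lift (∧-greatest (lower a≤x) (lower a≤y)))

  ↓-isDirected : ∀ a → IsDirected (↓ a)
  ↓-isDirected a x y x≤a y≤a = a , lift refl , lower x≤a , lower y≤a

  ↓-isOrderIdeal : ∀ a → IsOrderIdeal (↓ a)
  ↓-isOrderIdeal a =
    (a , lift refl) , (λ y≤x x≤a → lift (trans y≤x (lower x≤a))) , ↓-isDirected a

  UpClosure-isFilter : ∀ {D} → Nonempty D → IsDuallyDirected D → IsFilter (UpClosure D)
  UpClosure-isFilter (d , Dd) D-dd =
    (λ x≤y (d , Dd , d≤x) → d , Dd , trans d≤x x≤y) ,
    (d , Dd , maximum d) ,
    λ (d₁ , Dd₁ , d₁≤x) (d₂ , Dd₂ , d₂≤y) →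
      let (d , Dd , d≤d₁ , d≤d₂) = D-dd d₁ d₂ Dd₁ Dd₂
      in d , Dd , ∧-greatest (trans d≤d₁ d₁≤x) (trans d≤d₂ d₂≤y)

  DownClosure-isOrderIdeal : ∀ {S} → Nonempty S → IsDirected S → IsOrderIdeal (DownClosure S)
  DownClosure-isOrderIdeal (a , Sa) S-directed =
    (a , a , Sa , refl) ,
    (λ y≤x (a , Sa , x≤a) → a , Sa , trans y≤x x≤a) ,
    λ x y (a , Sa , x≤a) (b , Sb , y≤b) →
      let (d , Sd , a≤d , b≤d) = S-directed a b Sa Sb
      in d , (d , Sd , refl) , trans x≤a a≤d , trans y≤b b≤d

  isFilter : (P : X) → IsFilter (proj₁ P)
  isFilter P = proj₁ (proj₂ P)

  ∈-upward : (P : X) → IsUpset (proj₁ P)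
  ∈-upward P = proj₁ (isFilter P)

  isProper : (P : X) → IsProper (proj₁ P)
  isProper P = proj₁ (proj₂ (proj₂ P))

  ⋃β ⋂β : Subset → Pred X ℓA
  ⋃β S P = S ≬ proj₁ P
  ⋂β F P = F ⊆ proj₁ P

  ⋃β↓≐β : ∀ a → ⋃β (↓ a) ≐ β a
  ⋃β↓≐β a = (λ {P} (b , b≤a , Pb) → ∈-upward P (lower b≤a) Pb) , (λ Pa → a , lift refl , Pa)

  ⋂K-antitone : ∀ {S} {P Q : X} → proj₁ P ⊆ proj₁ Q → ⋂K S Q → ⋂K S P
  ⋂K-antitone P⊆Q Q∈⋂KS a Sa Pa = Q∈⋂KS a Sa (P⊆Q Pa)

  saturated-antitone : ∀ {U} → IsSubbasicSaturated U →
                       ∀ {P Q : X} → proj₁ P ⊆ proj₁ Q → U Q → U P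
  saturated-antitone (S , _ , U≐⋂KS) {P} {Q} P⊆Q UQ =
    proj₂ U≐⋂KS (⋂K-antitone {S} {P} {Q} P⊆Q (proj₁ U≐⋂KS UQ))

  directed⇒duallyDirectedFamily : ∀ {S} → IsDirected S → IsDuallyDirectedFamily S
  directed⇒duallyDirectedFamily S-directed a b Sa Sb =
    let (d , Sd , a≤d , b≤d) = S-directed a b Sa Sb
    in d , Sd , λ {P} P∌d → (P∌d ∘ ∈-upward P a≤d) , (P∌d ∘ ∈-upward P b≤d)

  ⋂∁ : Pred (Pred X ℓA) ℓA → Pred X (lsuc ℓA)
  ⋂∁ ℬ P = ∀ U → ℬ U → ∁ U P

  family : EX → Pred (Pred X ℓA) ℓA
  family Y = proj₁ (proj₂ Y)

  family-saturated : (Y : EX) → ∀ U → family Y U → IsSubbasicSaturated U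
  family-saturated Y = proj₁ (proj₂ (proj₂ Y))

  ≐⋂∁family : (Y : EX) → proj₁ Y ≐ ⋂∁ (family Y)
  ≐⋂∁family Y = proj₂ (proj₂ (proj₂ Y))

  EX-upward : (Y : EX) {P Q : X} → proj₁ P ⊆ proj₁ Q → proj₁ Y P → proj₁ Y Q
  EX-upward Y P⊆Q YP = proj₂ (≐⋂∁family Y) λ U U∈ℬ UQ →
    proj₁ (≐⋂∁family Y) YP U U∈ℬ (saturated-antitone (family-saturated Y U U∈ℬ) P⊆Q UQ)

  module _ (lem : ExcludedMiddle) where
    open Classical lem

    ∁⋂K≐⋃β : ∀ S → ∁ (⋂K S) ≐ ⋃β S
    ∁⋂K≐⋃β S =
      (λ P∉⋂KS → dne λ S∩P=∅ → P∉⋂KS λ a Sa Pa → S∩P=∅ (a , Sa , Pa)) ,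
      (λ (a , Sa , Pa) P∈⋂KS → P∈⋂KS a Sa Pa)

    ∉EX⇒∈family : (Y : EX) {P : X} → ¬ proj₁ Y P → ∃ λ U → family Y U × U P
    ∉EX⇒∈family Y P∉Y =
      dne λ ∄U → P∉Y (proj₂ (≐⋂∁family Y) λ U U∈ℬ UP → ∄U (U , U∈ℬ , UP))

    fromFamily : (ℬ : Pred (Pred X ℓA) ℓA) → (∀ U → ℬ U → IsSubbasicSaturated U) → EX
    fromFamily ℬ ℬ-saturated = (λ P → Resized ℓA (⋂∁ ℬ P)) , ℬ , ℬ-saturated , unresize , resize

    ⋂∁-singleton : ∀ V → ⋂∁ (λ U → Resized ℓA (U ≐ V)) ≐ ∁ V
    ⋂∁-singleton V =
      (λ P∈ → P∈ V (resize ≐-refl)) ,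
      (λ P∉V U U≐V UP → P∉V (proj₁ (unresize U≐V) UP))

    openE : (S : Subset) → IsDirected S → EX
    openE S S-directed = fromFamily (λ U → Resized ℓA (U ≐ ⋂K S))
      (λ U U≐⋂KS → S , directed⇒duallyDirectedFamily S-directed , unresize U≐⋂KS)

    openE≐⋃β : ∀ S S-directed → proj₁ (openE S S-directed) ≐ ⋃β S
    openE≐⋃β S S-directed =
      ≐-trans (≐⋂∁family (openE S S-directed)) (≐-trans (⋂∁-singleton (⋂K S)) (∁⋂K≐⋃β S))

    ⋃family : Pred EX (lsuc ℓA) → Pred (Pred X ℓA) ℓA
    ⋃family 𝒮 U = Resized ℓA (∃ λ Y → 𝒮 Y × family Y U)

    meetE : Pred EX (lsuc ℓA) → EX
    meetE 𝒮 = fromFamily (⋃family 𝒮)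
      (λ U U∈ℬ → let (Y , _ , U∈ℬY) = unresize U∈ℬ in family-saturated Y U U∈ℬY)

    ∈-meetE : ∀ {𝒮} {P : X} → (∀ Y → 𝒮 Y → proj₁ Y P) → proj₁ (meetE 𝒮) P
    ∈-meetE {𝒮} P∈𝒮 = resize λ U (U∈ℬ : ⋃family 𝒮 U) →
      let (Y , 𝒮Y , U∈ℬY) = unresize U∈ℬ in proj₁ (≐⋂∁family Y) (P∈𝒮 Y 𝒮Y) U U∈ℬY

    meetE-isGlb : ∀ 𝒮 → IsGlb EXposet 𝒮 (meetE 𝒮)
    meetE-isGlb 𝒮 =
      (λ Y 𝒮Y P∈ → proj₂ (≐⋂∁family Y) λ U U∈ℬY → unresize P∈ U (resize (Y , 𝒮Y , U∈ℬY))) ,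
      (λ W W-lower WP → ∈-meetE λ Y 𝒮Y → W-lower Y 𝒮Y WP)

    EX-isCompleteLattice : IsCompleteLattice EXposet
    EX-isCompleteLattice S =
      (meetE S , meetE-isGlb S) , lubs-from-glbs EXposet (λ T → meetE T , meetE-isGlb T) S

    e : Carrier → EX
    e a = openE (↓ a) (↓-isDirected a)

    e≐β : ∀ a → proj₁ (e a) ≐ β a
    e≐β a = ≐-trans (openE≐⋃β (↓ a) (↓-isDirected a)) (⋃β↓≐β a)

    e-mono : ∀ {a b} → a ≤ b → proj₁ (e a) ⊆ proj₁ (e b)
    e-mono {a} {b} a≤b {P} P∈ea = proj₂ (e≐β b) (∈-upward P a≤b (proj₁ (e≐β a) P∈ea))

    e-∧-isGlb : ∀ a b → IsGlb EXposet (λ Z → proj₁ Z ≐ proj₁ (e a) ⊎ proj₁ Z ≐ proj₁ (e b)) (e (a ∧ b))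
    e-∧-isGlb a b = lower-bound , greatest
      where
      ea-or-eb : Pred EX (lsuc ℓA)
      ea-or-eb Z = proj₁ Z ≐ proj₁ (e a) ⊎ proj₁ Z ≐ proj₁ (e b)
      lower-bound : IsLowerBound EXposet ea-or-eb (e (a ∧ b))
      lower-bound Z (inj₁ Z≐ea) P∈ = proj₂ Z≐ea (e-mono (x∧y≤x a b) P∈)
      lower-bound Z (inj₂ Z≐eb) P∈ = proj₂ Z≐eb (e-mono (x∧y≤y a b) P∈)
      greatest : ∀ W → IsLowerBound EXposet ea-or-eb W → proj₁ W ⊆ proj₁ (e (a ∧ b))
      greatest W W-lower {P} WP = proj₂ (e≐β (a ∧ b)) (proj₂ (proj₂ (isFilter P))
        (proj₁ (e≐β a) (W-lower (e a) (inj₁ ≐-refl) WP))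
        (proj₁ (e≐β b) (W-lower (e b) (inj₂ ≐-refl) WP)))

    e[_] : Subset → Pred EX (lsuc ℓA)
    e[ S ] = image EXposet e S

    openE-isLub : ∀ S S-directed → IsLub EXposet e[ S ] (openE S S-directed)
    openE-isLub S S-directed =
      (λ Z (a , Sa , Z≐ea) ZP → proj₂ openE≐ (a , Sa , proj₁ (e≐β a) (proj₁ Z≐ea ZP))) ,
      (λ W W-upper P∈ → let (a , Sa , Pa) = proj₁ openE≐ P∈
                        in W-upper (e a) (a , Sa , ≐-refl) (proj₂ (e≐β a) Pa))
      where
      openE≐ : proj₁ (openE S S-directed) ≐ ⋃β S
      openE≐ = openE≐⋃β S S-directed

    openE-isOpen : ∀ {I} (I-ideal : IsOrderIdeal I) → IsOpen EXposet e (openE I (proj₂ (proj₂ I-ideal)))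
    openE-isOpen {I} I-ideal = I , I-ideal , openE-isLub I (proj₂ (proj₂ I-ideal))

    lub⊆⋃β : ∀ {U j} → IsDirected U → IsLub EXposet e[ U ] j → proj₁ j ⊆ ⋃β U
    lub⊆⋃β {U} U-directed (_ , j-least) =
      proj₁ (openE≐⋃β U U-directed) ∘ j-least (openE U U-directed) (proj₁ (openE-isLub U U-directed))

    meetE-e[]≐⋂β : ∀ F → proj₁ (meetE e[ F ]) ≐ ⋂β F
    meetE-e[]≐⋂β F =
      (λ P∈ {a} Fa → proj₁ (e≐β a) (proj₁ (meetE-isGlb e[ F ]) (e a) (a , Fa , ≐-refl) P∈)) ,
      (λ F⊆P → ∈-meetE λ Z (a , Fa , Z≐ea) → proj₂ Z≐ea (proj₂ (e≐β a) (F⊆P Fa)))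

    ⋂β⊆glb : ∀ {D m} → IsGlb EXposet e[ D ] m → ⋂β D ⊆ proj₁ m
    ⋂β⊆glb {D} (_ , m-greatest) =
      m-greatest (meetE e[ D ]) (proj₁ (meetE-isGlb e[ D ])) ∘ proj₂ (meetE-e[]≐⋂β D)

    closed-below-containing : (x : EX) {P : X} → proj₁ x P →
      ∃ λ k → (IsClosed EXposet e k × proj₁ k ⊆ proj₁ x) × proj₁ k P
    closed-below-containing x {P} xP =
      meetE e[ proj₁ P ] ,
      ((proj₁ P , isFilter P , meetE-isGlb e[ proj₁ P ]) ,
       (λ Q∈k → EX-upward x (proj₁ (meetE-e[]≐⋂β (proj₁ P)) Q∈k) xP)) ,
      proj₂ (meetE-e[]≐⋂β (proj₁ P)) id

    module _ (zorn : ZornsLemma) where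

      module Admissible {F I : Subset} (F-filter : IsFilter F) (I-nonempty : Nonempty I)
                        (I-directed : IsDirected I) (I∩F=∅ : ¬ (I ≬ F)) where

        IsAdmissible : Subset → Set ℓA
        IsAdmissible G = IsFilter G × F ⊆ G × ¬ (I ≬ G)

        Admissibles : Poset (lsuc ℓA) ℓA ℓA
        Admissibles = On.poset (⊆-poset Carrier ℓA) (proj₁ {B = IsAdmissible})

        ∧-closed : (G : Σ Subset IsAdmissible) → ∀ {x y} → proj₁ G x → proj₁ G y → proj₁ G (x ∧ y)
        ∧-closed (_ , (_ , _ , G-∧) , _) = G-∧

        F⊆ : (G : Σ Subset IsAdmissible) → F ⊆ proj₁ G
        F⊆ (_ , _ , F⊆G , _) = F⊆G

        module _ (C : Pred (Σ Subset IsAdmissible) (lsuc ℓA)) (C-chain : IsChain Admissibles C) where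

          -- F is included so that the empty chain is bounded too.
          ⋃C : Carrier → Set (lsuc ℓA)
          ⋃C x = F x ⊎ ∃ λ G → C G × proj₁ G x

          ⋃C-upward : ∀ {x y} → x ≤ y → ⋃C x → ⋃C y
          ⋃C-upward x≤y (inj₁ Fx) = inj₁ (proj₁ F-filter x≤y Fx)
          ⋃C-upward x≤y (inj₂ ((G , (G-upward , _) , _) , CG , Gx)) =
            inj₂ (_ , CG , G-upward x≤y Gx)

          ⋃C-∧ : ∀ {x y} → ⋃C x → ⋃C y → ⋃C (x ∧ y)
          ⋃C-∧ (inj₁ Fx) (inj₁ Fy) = inj₁ (proj₂ (proj₂ F-filter) Fx Fy)
          ⋃C-∧ (inj₁ Fx) (inj₂ (G , CG , Gy)) = inj₂ (G , CG , ∧-closed G (F⊆ G Fx) Gy)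
          ⋃C-∧ (inj₂ (G , CG , Gx)) (inj₁ Fy) = inj₂ (G , CG , ∧-closed G Gx (F⊆ G Fy))
          ⋃C-∧ (inj₂ (G , CG , Gx)) (inj₂ (H , CH , Hy)) with C-chain G H CG CH
          ... | inj₁ G⊆H = inj₂ (H , CH , ∧-closed H (G⊆H Gx) Hy)
          ... | inj₂ H⊆G = inj₂ (G , CG , ∧-closed G Gx (H⊆G Hy))

          ⋃C-disjoint : ¬ (I ≬ ⋃C)
          ⋃C-disjoint (x , Ix , inj₁ Fx) = I∩F=∅ (x , Ix , Fx)
          ⋃C-disjoint (x , Ix , inj₂ ((_ , _ , _ , I∩G=∅) , _ , Gx)) = I∩G=∅ (x , Ix , Gx)

          chain-bounded : ∃ (IsUpperBoundOf Admissibles C)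
          chain-bounded =
            ((λ x → Resized ℓA (⋃C x)) ,
             ((λ x≤y → resize ∘ ⋃C-upward x≤y ∘ unresize) ,
              resize (inj₁ (proj₁ (proj₂ F-filter))) ,
              (λ x∈ y∈ → resize (⋃C-∧ (unresize x∈) (unresize y∈)))) ,
             resize ∘ inj₁ ,
             (λ (x , Ix , x∈) → ⋃C-disjoint (x , Ix , unresize x∈))) ,
            (λ G CG Gx → resize (inj₂ (G , CG , Gx)))

        module _ {G : Subset} (G-admissible : IsAdmissible G)
                 (G-maximal : IsMaximal Admissibles (G , G-admissible)) where

          private
            F⊆G : F ⊆ G
            F⊆G = proj₁ (proj₂ G-admissible)

            I∩G=∅ : ¬ (I ≬ G)
            I∩G=∅ = proj₂ (proj₂ G-admissible)

          strictly-larger-filter-meets : ∀ H → IsFilter H → G ⊆ H → ¬ (G ≐ H) → I ≬ H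
          strictly-larger-filter-meets H H-filter G⊆H G≉H = dne λ I∩H=∅ →
            G≉H (G⊆H , G-maximal (H , H-filter , G⊆H ∘ F⊆G , I∩H=∅) G⊆H)

          maximal-isProper : IsProper G
          maximal-isProper G-full = let (a , Ia) = I-nonempty in I∩G=∅ (a , Ia , G-full a)

          maximal-isIrreducible : ∀ F₁ F₂ → IsFilter F₁ → IsFilter F₂ →
                                  G ≐ (F₁ ∩ F₂) → (G ≐ F₁) ⊎ (G ≐ F₂)
          maximal-isIrreducible F₁ F₂ F₁-filter F₂-filter G≐F₁∩F₂ = dne λ neither →
            let (b₁ , Ib₁ , F₁b₁) = strictly-larger-filter-meets F₁ F₁-filter
                                      (proj₁ ∘ proj₁ G≐F₁∩F₂) (neither ∘ inj₁)
                (b₂ , Ib₂ , F₂b₂) = strictly-larger-filter-meets F₂ F₂-filter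
                                      (proj₂ ∘ proj₁ G≐F₁∩F₂) (neither ∘ inj₂)
                (d , Id , b₁≤d , b₂≤d) = I-directed b₁ b₂ Ib₁ Ib₂
                d∈G = proj₂ G≐F₁∩F₂ (proj₁ F₁-filter b₁≤d F₁b₁ , proj₁ F₂-filter b₂≤d F₂b₂)
            in I∩G=∅ (d , Id , d∈G)

      prime-filter-theorem : ∀ {F I} → IsFilter F → Nonempty I → IsDirected I → ¬ (I ≬ F) →
                             ∃ λ (P : X) → F ⊆ proj₁ P × ¬ ⋃β I P
      prime-filter-theorem F-filter I-nonempty I-directed I∩F=∅ =
        let ((G , G-admissible) , G-maximal) = zorn Admissibles chain-bounded
        in (G , proj₁ G-admissible , maximal-isProper G-admissible G-maximal ,
                maximal-isIrreducible G-admissible G-maximal) ,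
           proj₁ (proj₂ G-admissible) , proj₂ (proj₂ G-admissible)
        where open Admissible F-filter I-nonempty I-directed I∩F=∅

      β-reflects-≤ : ∀ {a b} → β a ⊆ β b → a ≤ b
      β-reflects-≤ {a} {b} βa⊆βb = dne λ a≰b →
        let (P , ↑a⊆P , P∉⋃β↓b) = prime-filter-theorem (↑-isFilter a) (b , lift refl)
                                    (↓-isDirected b)
                                    (λ (x , x≤b , a≤x) → a≰b (trans (lower a≤x) (lower x≤b)))
        in P∉⋃β↓b (b , lift refl , βa⊆βb {P} (↑a⊆P (lift refl)))

      duallyDirectedFamily⇒directed : ∀ {S} → IsDuallyDirectedFamily S → IsDirected S
      duallyDirectedFamily⇒directed S-dd a b Sa Sb =
        let (d , Sd , ∁βd⊆) = S-dd a b Sa Sb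
        in d , Sd , β-reflects-≤ (λ {P} Pa → dne λ P∌d → proj₁ (∁βd⊆ {P} P∌d) Pa)
                  , β-reflects-≤ (λ {P} Pb → dne λ P∌d → proj₂ (∁βd⊆ {P} P∌d) Pb)

      e-isSemilatticeEmbedding : IsSemilatticeEmbedding EXposet e
      e-isSemilatticeEmbedding =
        (λ a≈b → e-mono (reflexive a≈b) , e-mono (reflexive (Eq.sym a≈b))) ,
        (λ ea≐eb → antisym (e-reflects-≤ (proj₁ ea≐eb)) (e-reflects-≤ (proj₂ ea≐eb))) ,
        e-∧-isGlb ,
        (λ Z {P} _ → proj₂ (e≐β ⊤) (proj₁ (proj₂ (isFilter P))))
        where
        e-reflects-≤ : ∀ {a b} → proj₁ (e a) ⊆ proj₁ (e b) → a ≤ b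
        e-reflects-≤ {a} {b} ea⊆eb =
          β-reflects-≤ λ {P} Pa → proj₁ (e≐β b) (ea⊆eb {P} (proj₂ (e≐β a) Pa))

      separating-ideal : ∀ {S} {Y : Pred X ℓA} {P : X} → IsDuallyDirectedFamily S → ⋂K S P →
                         Y ⊆ ⋃β S → ∃ λ I → IsOrderIdeal I × ¬ ⋃β I P × Y ⊆ ⋃β I
      separating-ideal {S} {P = P} S-dd P∈⋂KS Y⊆⋃βS with lem (Nonempty S)
      ... | yes S-nonempty =
        DownClosure S ,
        DownClosure-isOrderIdeal S-nonempty (duallyDirectedFamily⇒directed S-dd) ,
        (λ (b , (a , Sa , b≤a) , Pb) → P∈⋂KS a Sa (∈-upward P b≤a Pb)) ,
        (λ YQ → let (a , Sa , Qa) = Y⊆⋃βS YQ in a , (a , Sa , refl) , Qa)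
      ... | no S-empty =
        let (c , P∌c) = dne λ P-full → isProper P λ a → dne λ P∌a → P-full (a , P∌a)
        in ↓ c , ↓-isOrderIdeal c ,
           (λ (b , b≤c , Pb) → P∌c (∈-upward P (lower b≤c) Pb)) ,
           (λ YQ → ⊥-elim (S-empty (let (a , Sa , _) = Y⊆⋃βS YQ in a , Sa)))

      open-above-avoiding : (x : EX) {P : X} → ¬ proj₁ x P →
        ∃ λ o → (IsOpen EXposet e o × proj₁ x ⊆ proj₁ o) × ¬ proj₁ o P
      open-above-avoiding x {P} P∉x =
        let (U , U∈ℬ , UP) = ∉EX⇒∈family x P∉x
            (S , S-dd , U≐⋂KS) = family-saturated x U U∈ℬ
            x⊆⋃βS : proj₁ x ⊆ ⋃β S
            x⊆⋃βS {Q} xQ = proj₁ (∁⋂K≐⋃β S) {Q} λ Q∈⋂KS →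
              proj₁ (≐⋂∁family x) xQ U U∈ℬ (proj₂ U≐⋂KS Q∈⋂KS)
            (I , I-ideal , P∉⋃βI , x⊆⋃βI) =
              separating-ideal {Y = proj₁ x} {P} S-dd (proj₁ U≐⋂KS UP) x⊆⋃βS
            o≐⋃βI = openE≐⋃β I (proj₂ (proj₂ I-ideal))
        in openE I (proj₂ (proj₂ I-ideal)) ,
           (openE-isOpen I-ideal , λ xQ → proj₂ o≐⋃βI (x⊆⋃βI xQ)) ,
           λ oP → P∉⋃βI (proj₁ o≐⋃βI oP)

      e-isDense : IsDense EXposet e
      e-isDense x =
        ((λ _ → proj₂) ,
         (λ w w-lower {P} wP → dne λ P∉x →
            let (o , o-open-above , P∉o) = open-above-avoiding x P∉x
            in P∉o (w-lower o o-open-above wP))) ,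
        ((λ _ → proj₂) ,
         (λ w w-upper xP →
            let (k , k-closed-below , kP) = closed-below-containing x xP
            in w-upper k k-closed-below kP))

      e-isCompact : IsCompact EXposet e
      e-isCompact D U D-nonempty D-dd U-nonempty U-directed m j m-glb j-lub m⊆j = dne λ no-witness →
        let (P , ↑D⊆P , P∉⋃βU) = prime-filter-theorem (UpClosure-isFilter D-nonempty D-dd)
                                   U-nonempty U-directed
                                   (λ (x , Ux , (d , Dd , d≤x)) → no-witness (d , x , Dd , Ux , d≤x))
            P∈m : proj₁ m P
            P∈m = ⋂β⊆glb {D} {m} m-glb {P} λ {d} Dd → ↑D⊆P {d} (d , Dd , refl)
        in P∉⋃βU (lub⊆⋃β {U} {j} U-directed j-lub {P} (m⊆j {P} P∈m))

      e-isCanonicalExtension : IsCanonicalExtension EXposet e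
      e-isCanonicalExtension =
        (EX-isCompleteLattice , e-isSemilatticeEmbedding) , e-isDense , e-isCompact

theorem6 : ExcludedMiddle → ZornsLemma →
    ∀ {c ℓ₁ ℓ₂} (A : BoundedMeetSemilattice c ℓ₁ ℓ₂) →
    ∃ λ (e : BoundedMeetSemilattice.Carrier A → SL.EX A) →
    (∀ a → proj₁ (e a) ≐ SL.β A a) ×
    SL.IsCanonicalExtension A (SL.EXposet A) e
theorem6 lem zorn A = e A lem , e≐β A lem , e-isCanonicalExtension A lem zorn
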